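{- Run the following algorithm on a properly vertex-colored digraph $(\vec G=(V,E),\sigma)$ with $V\neq\emptyset$, with an arbitrary rule for choosing partitions: initialize $\vec G^*\leftarrow\vec G$; compute $T=\mathrm{Edit}(V)$, where $\mathrm{Edit}(V')$ does the following: if $|V'|>1$, choose a partition $\mathscr V$ of $V'$ with $|\mathscr V|\ge 2$, replace $\vec G^*$ by $\vec G^*\triangle U(\vec G^*[V'],\mathscr V)$ (computed for the current $\vec G^*$ at the start of this step), create a new root $\rho'$, attach the trees $\mathrm{Edit}(V_i)$, $V_i\in\mathscr V$, as the subtrees of the children of $\rho'$, and return the resulting tree; if $|V'|=1$, return the tree consisting only of the single element of $V'$. Let $\vec G^*$ be the graph at termination. Then $(\vec G^*,\sigma)=\vec G(T,\sigma)$; in particular, $(\vec G^*,\sigma)$ is a best match graph.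
   Context: A digraph $\vec G=(V,E)$ has a finite vertex set and arc set $E\subseteq (V\times V)\setminus\{(v,v)\mid v\in V\}$; $\vec G\triangle F=(V,E\triangle F)$; $\vec G[W]$ is the induced subgraph on $W$, colored by $\sigma_{|W}$. A vertex coloring $\sigma$ is proper if adjacent vertices have distinct colors. All rooted trees are phylogenetic (every non-leaf vertex has at least two children); $L(T)$ is the leaf set, $\rho_T$ the root, $T(v)$ the subtree rooted at $v$, $\mathrm{child}_T(v)$ the children of $v$; $u\preceq_T v$ means $v$ lies on the path from $u$ to the root; $\mathrm{lca}_T$ is the last common ancestor. For a tree $T$ with leaf coloring $\sigma$, a leaf $y$ is a best match of a leaf $x$ if $\sigma(x)\ne\sigma(y)$ and $\mathrm{lca}_T(x,y)\preceq_T\mathrm{lca}_T(x,y')$ for all leaves $y'$ with $\sigma(y')=\sigma(y)$; the best match graph $\vec G(T,\sigma)$ has vertex set $L(T)$, coloring $\sigma$, and arcs $(x,y)$ whenever $y$ is a best match of $x$. A vertex-colored digraph is a best match graph (BMG) if it equals $\vec G(T,\sigma)$ for some leaf-colored tree. For a colored digraph $(\vec H=(W,E_H),\tau)$ and tree $T$ with $L(T)=W$, $U(\vec H,T)=E_H\triangle E(\vec G(T,\tau))$. For a partition $\mathscr W$ of $W$ with $|\mathscr W|\ge 2$, $\mathscr T(\mathscr W)$ is the set of phylogenetic trees $T$ with $L(T)=W$ and $\{L(T(v))\mid v\in\mathrm{child}_T(\rho_T)\}=\mathscr W$, and $U(\vec H,\mathscr W)=\bigcap_{T\in\mathscr T(\mathscr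 W)}U(\vec H,T)$. -}

module Defs where

open import Level using (Level; 0ℓ)
open import Data.Nat using (ℕ; _≤_)
open import Data.Fin using (Fin; toℕ)
open import Data.List using (List; []; _∷_; length; lookup; concat; _++_; allFin)
open import Data.List.Membership.Propositional using (_∈_)
open import Data.List.Relation.Unary.Unique.Propositional using (Unique)
open import Data.List.Relation.Unary.All using (All)
open import Data.List.Relation.Binary.Permutation.Propositional using (_↭_)
open import Data.Product using (Σ; ∃; _×_; _,_)
open import Data.Sum using (_⊎_)
open import Data.Empty using (⊥)
open import Relation.Nullary using (¬_)
open import Relation.Binary.PropositionalEquality using (_≡_; _≢_)
open import Function.Bundles using (_⇔_)

Arcs : Set → Set₁
Arcs V = V → V → Set

_△_ : {V : Set} → Arcs V → Arcs V → Arcs V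
(E △ F) x y = (E x y × ¬ F x y) ⊎ (¬ E x y × F x y)

induced : {V : Set} → Arcs V → List V → Arcs V
induced E W x y = E x y × x ∈ W × y ∈ W

NoLoops : {V : Set} → Arcs V → Set
NoLoops E = ∀ v → ¬ E v v

Proper : {V : Set} → Arcs V → (V → ℕ) → Set
Proper E σ = ∀ x y → E x y → σ x ≢ σ y

_≐ᴬ_ : {V : Set} → Arcs V → Arcs V → Set
E ≐ᴬ F = ∀ x y → E x y ⇔ F x y

data Tree (V : Set) : Set where
  leaf : V → Tree V
  node : List (Tree V) → Tree V

leaves : {V : Set} → Tree V → List V
leavesL : {V : Set} → List (Tree V) → List V
leaves (leaf v) = v ∷ []
leaves (node ts) = leavesL ts
leavesL [] = []
leavesL (t ∷ ts) = leaves t ++ leavesL ts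

Phylo : {V : Set} → Tree V → Set
PhyloL : {V : Set} → List (Tree V) → Set
Phylo (leaf v) = Data.Unit.⊤ where import Data.Unit
Phylo (node ts) = (2 ≤ length ts) × PhyloL ts
PhyloL [] = Data.Unit.⊤ where import Data.Unit
PhyloL (t ∷ ts) = Phylo t × PhyloL ts

_≐_ : {V : Set} → List V → List V → Set
A ≐ B = ∀ v → (v ∈ A) ⇔ (v ∈ B)

TreeOn : {V : Set} → Tree V → List V → Set
TreeOn T W = Phylo T × Unique (leaves T) × (leaves T ≐ W)

-- Vertices of a tree are addresses (paths of child indices from the root).
-- At T p S : the subtree T(p) rooted at address p is S.
data At {V : Set} : Tree V → List ℕ → Tree V → Set where
  here  : ∀ {T} → At T [] T
  there : ∀ {ts p S} (i : Fin (length ts)) →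
          At (lookup ts i) p S → At (node ts) (toℕ i ∷ p) S

Vtx : {V : Set} → Tree V → List ℕ → Set
Vtx T p = ∃ λ S → At T p S

-- u ⪯ v : v lies on the path from u to the root (v's address is a prefix)
_⪯_ : List ℕ → List ℕ → Set
u ⪯ v = ∃ λ q → u ≡ v ++ q

IsLca : {V : Set} → Tree V → List ℕ → List ℕ → List ℕ → Set
IsLca T a b w = Vtx T w × a ⪯ w × b ⪯ w ×
                (∀ v → Vtx T v → a ⪯ v → b ⪯ v → w ⪯ v)

BestMatch : {V : Set} → Tree V → (V → ℕ) → V → V → Set
BestMatch T σ x y =
  x ∈ leaves T × y ∈ leaves T × σ x ≢ σ y ×
  (∀ y' → y' ∈ leaves T → σ y' ≡ σ y →
   ∀ px py py' a a' →
   At T px (leaf x) → At T py (leaf y) → At T py' (leaf y') →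
   IsLca T px py a → IsLca T px py' a' → a ⪯ a')

BMG : {V : Set} → Tree V → (V → ℕ) → Arcs V
BMG T σ x y = BestMatch T σ x y

IsBMG : {V : Set} → Arcs V → (V → ℕ) → List V → Set
IsBMG E σ W = ∃ λ T → TreeOn T W × (E ≐ᴬ BMG T σ)

NonEmpty : {V : Set} → List V → Set
NonEmpty B = ∃ λ v → v ∈ B

IsPartition : {V : Set} → List V → List (List V) → Set
IsPartition W 𝒲 = All NonEmpty 𝒲 × (concat 𝒲 ↭ W)

RootBlocks : {V : Set} → Tree V → List (List V) → Set
RootBlocks (leaf _) 𝒲 = ⊥
RootBlocks (node ts) 𝒲 =
  (∀ t → t ∈ ts → ∃ λ B → B ∈ 𝒲 × (leaves t ≐ B)) ×
  (∀ B → B ∈ 𝒲 → ∃ λ t → t ∈ ts × (leaves t ≐ B))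

InTW : {V : Set} → List V → List (List V) → Tree V → Set
InTW W 𝒲 T = TreeOn T W × RootBlocks T 𝒲

UT : {V : Set} → Arcs V → (V → ℕ) → Tree V → Arcs V
UT H σ T = H △ BMG T σ

U𝒲 : {V : Set} → Arcs V → (V → ℕ) → List V → List (List V) → Arcs V
U𝒲 H σ W 𝒲 x y = ∀ T → InTW W 𝒲 T → UT H σ T x y

-- The algorithm, with arbitrary choice of partitions, as a relation:
-- Edit σ G* V' G*' T : running Edit(V') on current graph G* may return
-- the tree T and leave the graph G*'.

mutual
  data Edit {V : Set} (σ : V → ℕ) : Arcs V → List V → Arcs V → Tree V → Set₁ where
    single : ∀ {E v} → Edit σ E (v ∷ []) E (leaf v)
    split  : ∀ {E V' 𝒱 E' ts} →
             2 ≤ length V' →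
             IsPartition V' 𝒱 → 2 ≤ length 𝒱 →
             EditAll σ (E △ U𝒲 (induced E V') σ V' 𝒱) 𝒱 E' ts →
             Edit σ E V' E' (node ts)

  data EditAll {V : Set} (σ : V → ℕ) : Arcs V → List (List V) → Arcs V → List (Tree V) → Set₁ where
    []  : ∀ {E} → EditAll σ E [] E []
    _∷_ : ∀ {E E₁ E₂ B 𝒱 t ts} →
          Edit σ E B E₁ t → EditAll σ E₁ 𝒱 E₂ ts → EditAll σ E (B ∷ 𝒱) E₂ (t ∷ ts)

-- Induction over a run of the algorithm, with the invariant that Edit(W) returns a phylogenetic
-- tree T on W, leaves every arc with an endpoint outside W unchanged, and makes the arcs inside W
-- those of G(T, σ). At a split with partition 𝒱, for x in a block B and y outside B, y is a best
-- match of x in every tree of 𝒯(𝒱) iff the colour σ y does not occur in B. Hence U(G*[W], 𝒱)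
-- flips exactly the wrong arcs between blocks, and the recursive calls, which act only inside
-- blocks, leave them alone; the arcs inside a block are put right by the recursion.
--
-- Constructively the current arc set must also stay decidable, so U has to be decided on pairs
-- x, y inside one block B too: if σ x = σ y, or σ y occurs in B only at y, all trees of 𝒯(𝒱)
-- agree on (x, y); otherwise some y′ ≠ y of colour σ y lies in B, and trees with a cherry {x, y}
-- resp. {x, y′} inside B disagree, so (x, y) ∉ U.

module Submission where

open import Defs
open import Data.Nat using (ℕ; _≤_; s≤s; z≤n) renaming (_≟_ to _≟ℕ_)
open import Data.Fin using (Fin; toℕ; zero; suc)
open import Data.Fin.Properties using (toℕ-injective) renaming (_≟_ to _≟F_)
open import Data.List using (List; []; _∷_; length; lookup; concat; _++_; allFin; map)
open import Data.List.Properties using (++-assoc; ++-identityʳ; ∷-injectiveˡ; ∷-injectiveʳ)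
open import Data.List.Membership.Propositional using (_∈_; _∉_; _─_; find; lose)
open import Data.List.Membership.Propositional.Properties
  using (∈-++⁻; ∈-++⁺ˡ; ∈-++⁺ʳ; ∈-concat⁻′; ∈-map⁺; ∈-lookup; ∈-allFin)
open import Data.List.Relation.Unary.Any using (here; there; index; any?)
open import Data.List.Relation.Unary.Any.Properties using (lookup-index)
open import Data.List.Relation.Unary.All as All using (All; []; _∷_; all?)
open import Data.List.Relation.Unary.All.Properties using (++⁻ˡ)
open import Data.List.Relation.Unary.Unique.Propositional using (Unique; []; _∷_)
open import Data.List.Relation.Unary.Unique.Propositional.Properties using (allFin⁺)
open import Data.List.Relation.Binary.Disjoint.Propositional using (Disjoint)
open import Data.List.Relation.Binary.Pointwise using (Pointwise; []; _∷_)
open import Data.List.Relation.Binary.Pointwise.Properties using (Pointwise-length)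
open import Data.List.Relation.Binary.Permutation.Propositional
  using (_↭_; ↭-refl; ↭-reflexive; ↭-sym; ↭-trans; ↭-prep; ↭-swap; ↭⇒↭ₛ)
open import Data.List.Relation.Binary.Permutation.Propositional.Properties using (∈-resp-↭; ++⁺)
import Data.List.Relation.Binary.Permutation.Setoid.Properties as Setoid↭
open import Data.List.Relation.Binary.Subset.Propositional.Properties using (All-resp-⊇)
open import Data.Product as Prod using (∃; ∃₂; _×_; _,_; proj₁; proj₂)
open import Data.Sum as Sum using (_⊎_; inj₁; inj₂; [_,_])
open import Data.Empty using (⊥; ⊥-elim)
open import Data.Unit using (⊤; tt)
open import Function using (_∘_)
open import Function.Bundles using (_⇔_; mk⇔; Equivalence)
open import Function.Properties.Equivalence using ()
  renaming (refl to ⇔-refl; sym to ⇔-sym; trans to ⇔-trans)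
open import Relation.Binary.Definitions using (Decidable; DecidableEquality)
open import Relation.Binary.PropositionalEquality using (_≡_; _≢_; refl; sym; trans; cong; subst; setoid)
open import Relation.Nullary using (Dec; yes; no; ¬_; contradiction)
open import Relation.Nullary.Decidable using (¬?; _×-dec_; _⊎-dec_; decidable-stable)
  renaming (map to Dec-map)

open Equivalence using (to; from)

infix 3 _⊻_

_⊻_ : Set → Set → Set
A ⊻ B = (A × ¬ B) ⊎ (¬ A × B)

⊻-cong : {A A′ B B′ : Set} → A ⇔ A′ → B ⇔ B′ → (A ⊻ B) ⇔ (A′ ⊻ B′)
⊻-cong f g = mk⇔ (Sum.map (Prod.map (to f) (_∘ from g)) (Prod.map (_∘ from f) (to g)))
                 (Sum.map (Prod.map (from f) (_∘ to g)) (Prod.map (_∘ to f) (from g)))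

⊻? : {A B : Set} → Dec A → Dec B → Dec (A ⊻ B)
⊻? a? b? = (a? ×-dec ¬? b?) ⊎-dec (¬? a? ×-dec b?)

⊻-cancelˡ : {A B : Set} → Dec A → Dec B → (A ⊻ (A ⊻ B)) ⇔ B
⊻-cancelˡ {A} {B} a? b? = mk⇔ forth (back a?)
  where
  forth : A ⊻ (A ⊻ B) → B
  forth (inj₁ (a , ¬a⊻b))           = decidable-stable b? (λ ¬b → ¬a⊻b (inj₁ (a , ¬b)))
  forth (inj₂ (¬a , inj₁ (a , _)))   = contradiction a ¬a
  forth (inj₂ (_ , inj₂ (_ , b)))    = b
  back : Dec A → B → A ⊻ (A ⊻ B)
  back (yes a) b = inj₁ (a , [ (λ (_ , ¬b) → ¬b b) , (λ (¬a , _) → ¬a a) ])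
  back (no ¬a) b = inj₂ (¬a , inj₂ (¬a , b))

∀⊻-const : {I : Set} {P B : I → Set} {A Q : Set} → ∃ P → (∀ i → P i → B i ⇔ Q) →
           (∀ i → P i → A ⊻ B i) ⇔ (A ⊻ Q)
∀⊻-const (i₀ , p₀) B⇔Q = mk⇔ (λ h → to (⊻-cong ⇔-refl (B⇔Q i₀ p₀)) (h i₀ p₀))
                             (λ a⊻q i p → from (⊻-cong ⇔-refl (B⇔Q i p)) a⊻q)

module _ {A : Set} where

  Unique-resp-↭ : {xs ys : List A} → xs ↭ ys → Unique xs → Unique ys
  Unique-resp-↭ p = Setoid↭.Unique-resp-↭ (setoid A) (↭⇒↭ₛ p)

  Unique-++⁻ˡ : ∀ xs {ys : List A} → Unique (xs ++ ys) → Unique xs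
  Unique-++⁻ˡ []       _         = []
  Unique-++⁻ˡ (x ∷ xs) (x∉ ∷ xs!) = ++⁻ˡ xs x∉ ∷ Unique-++⁻ˡ xs xs!

  Unique-++⁻ʳ : ∀ xs {ys : List A} → Unique (xs ++ ys) → Unique ys
  Unique-++⁻ʳ []       ys!       = ys!
  Unique-++⁻ʳ (x ∷ xs) (_ ∷ xs!) = Unique-++⁻ʳ xs xs!

  Unique-++⇒Disjoint : ∀ xs {ys : List A} → Unique (xs ++ ys) → Disjoint xs ys
  Unique-++⇒Disjoint (x ∷ xs) (x∉ ∷ _)  (here refl  , v∈ys) = All.lookup x∉ (∈-++⁺ʳ xs v∈ys) refl
  Unique-++⇒Disjoint (x ∷ xs) (_ ∷ xs!) (there v∈xs , v∈ys) = Unique-++⇒Disjoint xs xs! (v∈xs , v∈ys)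

  Unique-concat⁻ : ∀ xss {xs : List A} → Unique (concat xss) → xs ∈ xss → Unique xs
  Unique-concat⁻ (xs ∷ xss) u (here refl) = Unique-++⁻ˡ xs u
  Unique-concat⁻ (ys ∷ xss) u (there m)   = Unique-concat⁻ xss (Unique-++⁻ʳ ys u) m

  ↭⇒≐ : {xs ys : List A} → xs ↭ ys → xs ≐ ys
  ↭⇒≐ p v = mk⇔ (∈-resp-↭ p) (∈-resp-↭ (↭-sym p))

  ∈-∷⁻ : {x u : A} {xs : List A} → u ∈ x ∷ xs → x ≢ u → u ∈ xs
  ∈-∷⁻ (here refl) x≢u = contradiction refl x≢u
  ∈-∷⁻ (there u∈)  _   = u∈

  ↭-─ : {x : A} {xs : List A} (x∈ : x ∈ xs) → xs ↭ x ∷ (xs ─ x∈)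
  ↭-─ (here refl) = ↭-refl
  ↭-─ (there x∈)  = ↭-trans (↭-prep _ (↭-─ x∈)) (↭-swap _ _ ↭-refl)

  Pointwise-∈ˡ : {B : Set} {R : A → B → Set} {xs : List A} {ys : List B} →
                 Pointwise R xs ys → ∀ {x} → x ∈ xs → ∃ λ y → y ∈ ys × R x y
  Pointwise-∈ˡ (r ∷ _)  (here refl) = _ , here refl , r
  Pointwise-∈ˡ (_ ∷ rs) (there m)   = Prod.map₂ (Prod.map₁ there) (Pointwise-∈ˡ rs m)

  Pointwise-∈ʳ : {B : Set} {R : A → B → Set} {xs : List A} {ys : List B} →
                 Pointwise R xs ys → ∀ {y} → y ∈ ys → ∃ λ x → x ∈ xs × R x y
  Pointwise-∈ʳ (r ∷ _)  (here refl) = _ , here refl , r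
  Pointwise-∈ʳ (_ ∷ rs) (there m)   = Prod.map₂ (Prod.map₁ there) (Pointwise-∈ʳ rs m)

⪯-root : ∀ u → u ⪯ []
⪯-root u = u , refl

⪯-trans : ∀ {u v w} → u ⪯ v → v ⪯ w → u ⪯ w
⪯-trans {w = w} (q , refl) (q′ , refl) = q′ ++ q , ++-assoc w q′ q

∷-mono-⪯ : ∀ {k : ℕ} {u v} → u ⪯ v → (k ∷ u) ⪯ (k ∷ v)
∷-mono-⪯ (q , e) = q , cong (_ ∷_) e

∷-cancel-⪯ : ∀ {k : ℕ} {u v} → (k ∷ u) ⪯ (k ∷ v) → u ⪯ v
∷-cancel-⪯ (q , e) = q , ∷-injectiveʳ e

distinct-heads-⪯⇒≡[] : ∀ {k l : ℕ} {p q v} → k ≢ l → (k ∷ p) ⪯ v → (l ∷ q) ⪯ v → v ≡ []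
distinct-heads-⪯⇒≡[] {v = []}    _   _        _        = refl
distinct-heads-⪯⇒≡[] {v = _ ∷ _} k≢l (_ , e₁) (_ , e₂) =
  ⊥-elim (k≢l (trans (∷-injectiveˡ e₁) (sym (∷-injectiveˡ e₂))))

module _ {V : Set} where

  ∈-leaves-child : ∀ ts (i : Fin (length ts)) {x : V} → x ∈ leaves (lookup ts i) → x ∈ leavesL ts
  ∈-leaves-child (t ∷ ts) zero    x∈ = ∈-++⁺ˡ x∈
  ∈-leaves-child (t ∷ ts) (suc i) x∈ = ∈-++⁺ʳ (leaves t) (∈-leaves-child ts i x∈)

  ∈-leavesL⁻ : ∀ ts {x : V} → x ∈ leavesL ts → ∃ λ i → x ∈ leaves (lookup ts i)
  ∈-leavesL⁻ (t ∷ ts) x∈ with ∈-++⁻ (leaves t) x∈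
  ... | inj₁ x∈t  = zero , x∈t
  ... | inj₂ x∈ts = let i , x∈i = ∈-leavesL⁻ ts x∈ts in suc i , x∈i

  child-unique : ∀ ts → Unique (leavesL ts) → ∀ i j {x : V} →
                 x ∈ leaves (lookup ts i) → x ∈ leaves (lookup ts j) → i ≡ j
  child-unique (t ∷ ts) u zero    zero    _   _   = refl
  child-unique (t ∷ ts) u zero    (suc j) x∈t x∈j =
    ⊥-elim (Unique-++⇒Disjoint (leaves t) u (x∈t , ∈-leaves-child ts j x∈j))
  child-unique (t ∷ ts) u (suc i) zero    x∈i x∈t =
    ⊥-elim (Unique-++⇒Disjoint (leaves t) u (x∈t , ∈-leaves-child ts i x∈i))
  child-unique (t ∷ ts) u (suc i) (suc j) x∈i x∈j =
    cong suc (child-unique ts (Unique-++⁻ʳ (leaves t) u) i j x∈i x∈j)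

  Unique-child : ∀ ts (i : Fin (length ts)) → Unique (leavesL ts) →
                 Unique {A = V} (leaves (lookup ts i))
  Unique-child (t ∷ ts) zero    u = Unique-++⁻ˡ (leaves t) u
  Unique-child (t ∷ ts) (suc i) u = Unique-child ts i (Unique-++⁻ʳ (leaves t) u)

  At-leaf⇒∈ : ∀ {T p} {x : V} → At T p (leaf x) → x ∈ leaves T
  At-leaf⇒∈ here               = here refl
  At-leaf⇒∈ (there {ts} i at) = ∈-leaves-child ts i (At-leaf⇒∈ at)

  ∈⇒At-leaf  : ∀ T {x : V} → x ∈ leaves T → ∃ λ p → At T p (leaf x)
  ∈⇒At-leafL : ∀ ts {x : V} → x ∈ leavesL ts → ∃₂ λ i p → At (lookup ts i) p (leaf x)
  ∈⇒At-leaf (leaf v)  (here refl) = [] , here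
  ∈⇒At-leaf (node ts) x∈ with ∈⇒At-leafL ts x∈
  ... | i , p , at = toℕ i ∷ p , there i at
  ∈⇒At-leafL (t ∷ ts) x∈ with ∈-++⁻ (leaves t) x∈
  ... | inj₁ x∈t  = zero , ∈⇒At-leaf t x∈t
  ... | inj₂ x∈ts = let i , at = ∈⇒At-leafL ts x∈ts in suc i , at

  At-leaf-child : ∀ ts → Unique (leavesL ts) → ∀ i {x : V} {px} → x ∈ leaves (lookup ts i) →
                  At (node ts) px (leaf x) → ∃ λ p → px ≡ toℕ i ∷ p × At (lookup ts i) p (leaf x)
  At-leaf-child ts u i x∈ (there j at) with child-unique ts u j i (At-leaf⇒∈ at) x∈
  ... | refl = _ , refl , at

  At-leaf-unique : ∀ {T p q} {x : V} → Unique (leaves T) →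
                   At T p (leaf x) → At T q (leaf x) → p ≡ q
  At-leaf-unique u here here = refl
  At-leaf-unique {node ts} u (there i at) at′ with At-leaf-child ts u i (At-leaf⇒∈ at) at′
  ... | _ , refl , at″ = cong (toℕ i ∷_) (At-leaf-unique (Unique-child ts i u) at at″)

  At-node⁻ : ∀ {ts k p} {S : Tree V} → At (node ts) (k ∷ p) S →
             ∃ λ i → toℕ i ≡ k × At (lookup ts i) p S
  At-node⁻ (there i at) = i , refl , at

  lca-least : ∀ {T : Tree V} {p q w w′} → IsLca T p q w → IsLca T p q w′ → w ⪯ w′
  lca-least (_ , _ , _ , least) (w′∈T , p⪯w′ , q⪯w′ , _) = least _ w′∈T p⪯w′ q⪯w′

  lca-rootˡ : ∀ {T : Tree V} q → IsLca T [] q []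
  lca-rootˡ {T} q = (T , here) , ⪯-root [] , ⪯-root q , λ _ _ []⪯v _ → []⪯v

  lca-rootʳ : ∀ {T : Tree V} p → IsLca T p [] []
  lca-rootʳ {T} p = (T , here) , ⪯-root p , ⪯-root [] , λ _ _ _ []⪯v → []⪯v

  lca-distinct-children : ∀ ts {i j : Fin (length ts)} → i ≢ j → ∀ p q →
                          IsLca {V} (node ts) (toℕ i ∷ p) (toℕ j ∷ q) []
  lca-distinct-children ts i≢j p q = (node ts , here) , ⪯-root _ , ⪯-root _ , λ v _ ip⪯v jq⪯v →
    subst ([] ⪯_) (sym (distinct-heads-⪯⇒≡[] (i≢j ∘ toℕ-injective) ip⪯v jq⪯v)) (⪯-root [])

  ⪯-lca-distinct-children : ∀ {T : Tree V} {k l p q a′} → IsLca T (k ∷ p) (l ∷ q) a′ → k ≢ l →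
                            ∀ a → a ⪯ a′
  ⪯-lca-distinct-children (_ , kp⪯a′ , lq⪯a′ , _) k≢l a =
    subst (a ⪯_) (sym (distinct-heads-⪯⇒≡[] k≢l kp⪯a′ lq⪯a′)) (⪯-root a)

  lca-child : ∀ {ts} (i : Fin (length ts)) {p q a} → IsLca {V} (lookup ts i) p q a →
              IsLca (node ts) (toℕ i ∷ p) (toℕ i ∷ q) (toℕ i ∷ a)
  lca-child {ts} i {p} {q} {a} ((S , at) , p⪯a , q⪯a , least) =
    (S , there i at) , ∷-mono-⪯ p⪯a , ∷-mono-⪯ q⪯a , least′
    where
    least′ : ∀ v → Vtx (node ts) v → (toℕ i ∷ p) ⪯ v → (toℕ i ∷ q) ⪯ v → (toℕ i ∷ a) ⪯ v
    least′ []      _          _        _         = ⪯-root _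
    least′ (k ∷ v) (S′ , at′) (r , e₁) (r′ , e₂) with At-node⁻ at′ | ∷-injectiveˡ e₁
    ... | j , j≡k , at″ | refl with toℕ-injective j≡k
    ... | refl = ∷-mono-⪯ (least v (S′ , at″) (r , ∷-injectiveʳ e₁) (r′ , ∷-injectiveʳ e₂))

  lca-exists : ∀ {T : Tree V} {p q S S′} → At T p S → At T q S′ → ∃ (IsLca T p q)
  lca-exists {q = q} here        _    = [] , lca-rootˡ q
  lca-exists {p = p} (there _ _) here = [] , lca-rootʳ p
  lca-exists {node ts} (there i at) (there j at′) with i ≟F j
  ... | yes refl = Prod.map (toℕ i ∷_) (lca-child i) (lca-exists at at′)
  ... | no i≢j   = [] , lca-distinct-children ts i≢j _ _

  _spans_ : Tree V → List V → Set
  T spans B = Phylo T × leaves T ↭ B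

  spans⇒TreeOn : ∀ {T W} → Unique W → T spans W → TreeOn T W
  spans⇒TreeOn W! (phylo , leaves↭W) = phylo , Unique-resp-↭ (↭-sym leaves↭W) W! , ↭⇒≐ leaves↭W

  spans-resp-↭ : ∀ {T B B′} → T spans B → B ↭ B′ → T spans B′
  spans-resp-↭ (phylo , leaves↭B) B↭B′ = phylo , ↭-trans leaves↭B B↭B′

  PhyloL-spans : ∀ {ts 𝒱} → Pointwise _spans_ ts 𝒱 → PhyloL ts
  PhyloL-spans []                = tt
  PhyloL-spans ((phylo , _) ∷ ps) = phylo , PhyloL-spans ps

  leavesL-spans : ∀ {ts 𝒱} → Pointwise _spans_ ts 𝒱 → leavesL ts ↭ concat 𝒱
  leavesL-spans []                  = ↭-refl
  leavesL-spans ((_ , leaves↭) ∷ ps) = ++⁺ leaves↭ (leavesL-spans ps)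

  node-spans : ∀ {ts 𝒱} → 2 ≤ length 𝒱 → Pointwise _spans_ ts 𝒱 → node ts spans concat 𝒱
  node-spans 2≤ ps =
    (subst (2 ≤_) (sym (Pointwise-length ps)) 2≤ , PhyloL-spans ps) , leavesL-spans ps

  Pointwise-spans⇒RootBlocks : ∀ {ts 𝒱} → Pointwise _spans_ ts 𝒱 → RootBlocks (node ts) 𝒱
  Pointwise-spans⇒RootBlocks ps =
    (λ t t∈ → Prod.map₂ (Prod.map₂ (↭⇒≐ ∘ proj₂)) (Pointwise-∈ˡ ps t∈)) ,
    (λ B B∈ → Prod.map₂ (Prod.map₂ (↭⇒≐ ∘ proj₂)) (Pointwise-∈ʳ ps B∈))

  spans-map : ∀ (g : List V → Tree V) {𝒱} → (∀ {B} → B ∈ 𝒱 → g B spans B) →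
              Pointwise _spans_ (map g 𝒱) 𝒱
  spans-map g {[]}    _       = []
  spans-map g {B ∷ 𝒱} g-spans = g-spans (here refl) ∷ spans-map g (g-spans ∘ there)

  -- A single tree is not wrapped in a new root, so that the result stays phylogenetic.
  graft : List (Tree V) → Tree V
  graft (t ∷ []) = t
  graft ts       = node ts

  leaves-graft : ∀ ts → leaves (graft ts) ≡ leavesL ts
  leaves-graft []           = refl
  leaves-graft (t ∷ [])     = sym (++-identityʳ (leaves t))
  leaves-graft (t ∷ _ ∷ _)  = refl

  Phylo-graft : ∀ t ts → PhyloL (t ∷ ts) → Phylo (graft (t ∷ ts))
  Phylo-graft t []       (phylo , _) = phylo
  Phylo-graft t (_ ∷ _)  phylos      = s≤s (s≤s z≤n) , phylos

  leavesL-map-leaf : ∀ (R : List V) → leavesL (map leaf R) ≡ R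
  leavesL-map-leaf []      = refl
  leavesL-map-leaf (r ∷ R) = cong (r ∷_) (leavesL-map-leaf R)

  PhyloL-map-leaf : ∀ (R : List V) → PhyloL (map leaf R)
  PhyloL-map-leaf []      = tt
  PhyloL-map-leaf (r ∷ R) = tt , PhyloL-map-leaf R

  star : List V → Tree V
  star B = graft (map leaf B)

  star-spans : ∀ {B} → NonEmpty B → star B spans B
  star-spans {v ∷ B} _ =
    Phylo-graft (leaf v) (map leaf B) (tt , PhyloL-map-leaf B) ,
    ↭-reflexive (trans (leaves-graft (map leaf (v ∷ B))) (leavesL-map-leaf (v ∷ B)))

  cherry : V → V → List V → Tree V
  cherry x u R = graft (node (leaf x ∷ leaf u ∷ []) ∷ map leaf R)

  leaves-cherry : ∀ x u R → leaves (cherry x u R) ≡ x ∷ u ∷ R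
  leaves-cherry x u R = trans (leaves-graft (node (leaf x ∷ leaf u ∷ []) ∷ map leaf R))
                              (cong (λ L → x ∷ u ∷ L) (leavesL-map-leaf R))

  cherry-spans : ∀ x u R → cherry x u R spans (x ∷ u ∷ R)
  cherry-spans x u R =
    Phylo-graft _ (map leaf R) ((s≤s (s≤s z≤n) , tt , tt , tt) , PhyloL-map-leaf R) ,
    ↭-reflexive (leaves-cherry x u R)

module _ {V : Set} (σ : V → ℕ) where

  Nearest : Tree V → V → V → Set
  Nearest T x y = ∀ y′ → y′ ∈ leaves T → σ y′ ≡ σ y → ∀ px py py′ a a′ →
                  At T px (leaf x) → At T py (leaf y) → At T py′ (leaf y′) →
                  IsLca T px py a → IsLca T px py′ a′ → a ⪯ a′

  ColourAbsent : ℕ → List V → Set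
  ColourAbsent c B = All (λ z → σ z ≢ c) B

  colourAbsent? : ∀ c B → Dec (ColourAbsent c B)
  colourAbsent? c B = all? (λ z → ¬? (σ z ≟ℕ c)) B

  bestMatch⇒colours≢ : ∀ {T x y} → BestMatch T σ x y → σ x ≢ σ y
  bestMatch⇒colours≢ (_ , _ , σx≢σy , _) = σx≢σy

  bestMatch-child⇒node : ∀ ts → Unique (leavesL ts) → ∀ i {x y} →
                         BestMatch (lookup ts i) σ x y → BestMatch (node ts) σ x y
  bestMatch-child⇒node ts ts! i {x} {y} (x∈ , y∈ , σx≢σy , nearest) =
    ∈-leaves-child ts i x∈ , ∈-leaves-child ts i y∈ , σx≢σy , nearest′
    where
    nearest′ : Nearest (node ts) x y
    nearest′ y′ _ σy′≡σy px py py′ a a′ atx aty aty′ lca lca′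
      with At-leaf-child ts ts! i x∈ atx | At-leaf-child ts ts! i y∈ aty
    ... | p , refl , atxᵢ | q , refl , atyᵢ with lca-exists atxᵢ atyᵢ
    ... | b , lca-b = ⪯-trans (lca-least lca (lca-child i lca-b)) (ib⪯a′ aty′ lca′)
      where
      ib⪯a′ : ∀ {py′} → At (node ts) py′ (leaf y′) → IsLca (node ts) (toℕ i ∷ p) py′ a′ →
              (toℕ i ∷ b) ⪯ a′
      ib⪯a′ (there j aty′) lca′ with j ≟F i
      ... | no j≢i = ⪯-lca-distinct-children lca′ (j≢i ∘ toℕ-injective ∘ sym) _
      ... | yes refl with lca-exists atxᵢ aty′
      ... | b′ , lca-b′ =
        ⪯-trans (∷-mono-⪯ (nearest y′ (At-leaf⇒∈ aty′) σy′≡σy _ _ _ _ _ atxᵢ atyᵢ aty′ lca-b lca-b′))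
                (lca-least (lca-child i lca-b′) lca′)

  bestMatch-node⇒child : ∀ ts i {x y} → x ∈ leaves (lookup ts i) → y ∈ leaves (lookup ts i) →
                         BestMatch (node ts) σ x y → BestMatch (lookup ts i) σ x y
  bestMatch-node⇒child ts i x∈ y∈ (_ , _ , σx≢σy , nearest) = x∈ , y∈ , σx≢σy ,
    λ y′ y′∈ σy′≡σy p q q′ b b′ atx aty aty′ lca lca′ →
      ∷-cancel-⪯ (nearest y′ (∈-leaves-child ts i y′∈) σy′≡σy _ _ _ _ _
                   (there i atx) (there i aty) (there i aty′) (lca-child i lca) (lca-child i lca′))

  bestMatch-child⇔node : ∀ ts → Unique (leavesL ts) → ∀ i {x y} →
                         x ∈ leaves (lookup ts i) → y ∈ leaves (lookup ts i) →
                         BestMatch (lookup ts i) σ x y ⇔ BestMatch (node ts) σ x y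
  bestMatch-child⇔node ts ts! i x∈ y∈ =
    mk⇔ (bestMatch-child⇒node ts ts! i) (bestMatch-node⇒child ts i x∈ y∈)

  -- Every leaf outside the child of x meets x at the root, so only that child can offer a closer
  -- leaf of colour σ y.
  bestMatch-across : ∀ ts → Unique (leavesL ts) → ∀ i {x y} → x ∈ leaves (lookup ts i) →
                     y ∈ leavesL ts → ColourAbsent (σ y) (leaves (lookup ts i)) →
                     BestMatch (node ts) σ x y
  bestMatch-across ts ts! i {x} {y} x∈ y∈ absent =
    ∈-leaves-child ts i x∈ , y∈ , All.lookup absent x∈ , nearest
    where
    nearest : Nearest (node ts) x y
    nearest y′ _ σy′≡σy px py py′ a a′ atx aty aty′ lca lca′ with At-leaf-child ts ts! i x∈ atx
    ... | p , refl , _ = a⪯a′ aty′ lca′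
      where
      a⪯a′ : ∀ {py′} → At (node ts) py′ (leaf y′) → IsLca (node ts) (toℕ i ∷ p) py′ a′ → a ⪯ a′
      a⪯a′ (there j aty′) lca′ with j ≟F i
      ... | yes refl = contradiction σy′≡σy (All.lookup absent (At-leaf⇒∈ aty′))
      ... | no j≢i   = ⪯-lca-distinct-children lca′ (j≢i ∘ toℕ-injective ∘ sym) a

  bestMatch-across⁻ : ∀ ts i {x y} → x ∈ leaves (lookup ts i) → y ∉ leaves (lookup ts i) →
                      BestMatch (node ts) σ x y → ColourAbsent (σ y) (leaves (lookup ts i))
  bestMatch-across⁻ ts i {x} {y} x∈ y∉ (_ , y∈ , _ , nearest) = All.tabulate colour≢
    where
    colour≢ : ∀ {z} → z ∈ leaves (lookup ts i) → σ z ≢ σ y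
    colour≢ {z} z∈ σz≡σy
      with ∈⇒At-leaf (lookup ts i) x∈ | ∈⇒At-leaf (lookup ts i) z∈ | ∈⇒At-leaf (node ts) y∈
    ... | p , atx | _ , atz | _ , there j aty with j ≟F i
    ...   | yes refl = y∉ (At-leaf⇒∈ aty)
    ...   | no j≢i with lca-exists atx atz
    ...     | b , lca-b = []⪯⇒≢ (nearest z (∈-leaves-child ts i z∈) σz≡σy _ _ _ [] (toℕ i ∷ b)
                                   (there i atx) (there j aty) (there i atz)
                                   (lca-distinct-children ts (j≢i ∘ sym) p _) (lca-child i lca-b))
      where
      []⪯⇒≢ : ∀ {k : ℕ} {v} → ¬ ([] ⪯ (k ∷ v))
      []⪯⇒≢ (_ , ())

  bestMatch-uniqueColour : ∀ T → Unique (leaves T) → ∀ {x y} → x ∈ leaves T → y ∈ leaves T →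
                           σ x ≢ σ y → (∀ y′ → y′ ∈ leaves T → σ y′ ≡ σ y → y′ ≡ y) →
                           BestMatch T σ x y
  bestMatch-uniqueColour T T! x∈ y∈ σx≢σy unique = x∈ , y∈ , σx≢σy , nearest
    where
    nearest : Nearest T _ _
    nearest y′ y′∈ σy′≡σy _ _ _ _ _ _ aty aty′ lca lca′ with unique y′ y′∈ σy′≡σy
    ... | refl with At-leaf-unique T! aty aty′
    ... | refl = lca-least lca lca′

  bestMatch-graft : ∀ t ts {x y} → Unique (leaves (graft (t ∷ ts))) →
                    BestMatch t σ x y → BestMatch (graft (t ∷ ts)) σ x y
  bestMatch-graft t []      _  bm = bm
  bestMatch-graft t (_ ∷ _) u! bm = bestMatch-child⇒node (t ∷ _ ∷ _) u! zero bm

  bestMatch-cherry : ∀ x u R → Unique (x ∷ u ∷ R) → σ x ≢ σ u → BestMatch (cherry x u R) σ x u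
  bestMatch-cherry x u R xuR! σx≢σu =
    bestMatch-graft pair (map leaf R) (subst Unique (sym (leaves-cherry x u R)) xuR!)
      (bestMatch-across (leaf x ∷ leaf u ∷ []) (Unique-++⁻ˡ (x ∷ u ∷ []) xuR!) zero
                        (here refl) (there (here refl)) (σx≢σu ∷ []))
    where pair = node (leaf x ∷ leaf u ∷ [])

  ¬bestMatch-cherry : ∀ x u R {y} → Unique (x ∷ u ∷ R) → y ∈ R → σ u ≡ σ y →
                      ¬ BestMatch (cherry x u R) σ x y
  ¬bestMatch-cherry x u (r ∷ R) {y} (x∉ ∷ u∉ ∷ _) y∈R σu≡σy bm =
    All.lookup (bestMatch-across⁻ (pair ∷ leaf r ∷ map leaf R) zero (here refl) y∉ bm)
               (there (here refl)) σu≡σy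
    where
    pair = node (leaf x ∷ leaf u ∷ [])
    y∉ : y ∉ x ∷ u ∷ []
    y∉ (here refl)         = All.lookup x∉ (there y∈R) refl
    y∉ (there (here refl)) = All.lookup u∉ y∈R refl

  module _ (_≟_ : DecidableEquality V) where

    open import Data.List.Membership.DecPropositional _≟_ using (_∈?_)

    cherryOrStar : V → V → List V → Tree V
    cherryOrStar x u B with x ∈? B
    ... | no _ = star B
    ... | yes x∈B with u ∈? B ─ x∈B
    ...   | no _   = star B
    ...   | yes u∈ = cherry x u ((B ─ x∈B) ─ u∈)

    cherryOrStar-spans : ∀ x u {B} → NonEmpty B → cherryOrStar x u B spans B
    cherryOrStar-spans x u {B} B≠[] with x ∈? B
    ... | no _ = star-spans B≠[]
    ... | yes x∈B with u ∈? B ─ x∈B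
    ...   | no _   = star-spans B≠[]
    ...   | yes u∈ =
      spans-resp-↭ (cherry-spans x u _) (↭-sym (↭-trans (↭-─ x∈B) (↭-prep x (↭-─ u∈))))

    cherryOrStar≡cherry : ∀ {x u B} → x ∈ B → u ∈ B → x ≢ u →
                          ∃ λ R → cherryOrStar x u B ≡ cherry x u R × B ↭ x ∷ u ∷ R
    cherryOrStar≡cherry {x} {u} {B} x∈B u∈B x≢u with x ∈? B
    ... | no x∉B = contradiction x∈B x∉B
    ... | yes x∈B′ with u ∈? B ─ x∈B′
    ...   | no u∉  = contradiction (∈-∷⁻ (∈-resp-↭ (↭-─ x∈B′) u∈B) x≢u) u∉
    ...   | yes u∈ = _ , refl , ↭-trans (↭-─ x∈B′) (↭-prep x (↭-─ u∈))

    module Partition {W : List V} (W! : Unique W) {𝒱 : List (List V)} (𝒱-part : IsPartition W 𝒱)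
                     (2≤|𝒱| : 2 ≤ length 𝒱) where

      𝒯 : Tree V → Set
      𝒯 = InTW W 𝒱

      node∈𝒯 : ∀ {ts} → Pointwise _spans_ ts 𝒱 → 𝒯 (node ts)
      node∈𝒯 ps = spans⇒TreeOn W! (spans-resp-↭ (node-spans 2≤|𝒱| ps) (proj₂ 𝒱-part)) ,
                  Pointwise-spans⇒RootBlocks ps

      𝒯⇒Unique : ∀ {T} → 𝒯 T → Unique (leaves T)
      𝒯⇒Unique ((_ , T! , _) , _) = T!

      𝒯⇒leaves≐ : ∀ {T} → 𝒯 T → leaves T ≐ W
      𝒯⇒leaves≐ ((_ , _ , leaves≐W) , _) = leaves≐W

      block-nonempty : ∀ {B} → B ∈ 𝒱 → NonEmpty B
      block-nonempty = All.lookup (proj₁ 𝒱-part)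

      block-unique : ∀ {B} → B ∈ 𝒱 → Unique B
      block-unique = Unique-concat⁻ 𝒱 (Unique-resp-↭ (↭-sym (proj₂ 𝒱-part)) W!)

      block-of : ∀ {x} → x ∈ W → ∃ λ B → B ∈ 𝒱 × x ∈ B
      block-of x∈W with ∈-concat⁻′ 𝒱 (∈-resp-↭ (↭-sym (proj₂ 𝒱-part)) x∈W)
      ... | B , x∈B , B∈ = B , B∈ , x∈B

      child-of-block : ∀ {T} → 𝒯 T → ∀ {B} → B ∈ 𝒱 →
                       ∃₂ λ ts i → T ≡ node ts × leaves (lookup ts i) ≐ B
      child-of-block {node ts} (_ , _ , covers) B∈ with covers _ B∈
      ... | t , t∈ , t≐B =
        ts , index t∈ , refl , subst (λ t′ → leaves t′ ≐ _) (lookup-index t∈) t≐B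

      starForest : Tree V
      starForest = node (map star 𝒱)

      starForest∈𝒯 : 𝒯 starForest
      starForest∈𝒯 = node∈𝒯 (spans-map star (star-spans ∘ block-nonempty))

      cherryForest : V → V → Tree V
      cherryForest x u = node (map (cherryOrStar x u) 𝒱)

      cherryForest∈𝒯 : ∀ x u → 𝒯 (cherryForest x u)
      cherryForest∈𝒯 x u =
        node∈𝒯 (spans-map (cherryOrStar x u) (cherryOrStar-spans x u ∘ block-nonempty))

      cherryForest-child : ∀ {B x u} → B ∈ 𝒱 → x ∈ B → u ∈ B → x ≢ u →
                           ∃₂ λ i R → lookup (map (cherryOrStar x u) 𝒱) i ≡ cherry x u R ×
                                      B ↭ x ∷ u ∷ R
      cherryForest-child {x = x} {u} B∈ x∈B u∈B x≢u with cherryOrStar≡cherry x∈B u∈B x≢u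
      ... | R , tree≡ , B↭ = index t∈ , R , trans (sym (lookup-index t∈)) tree≡ , B↭
        where t∈ = ∈-map⁺ (cherryOrStar x u) B∈

      cherryForest-bestMatch : ∀ {B x u} → B ∈ 𝒱 → x ∈ B → u ∈ B → σ x ≢ σ u →
                               BestMatch (cherryForest x u) σ x u
      cherryForest-bestMatch {x = x} {u} B∈ x∈B u∈B σx≢σu
        with cherryForest-child B∈ x∈B u∈B (σx≢σu ∘ cong σ)
      ... | i , R , child≡ , B↭ =
        bestMatch-child⇒node _ (𝒯⇒Unique (cherryForest∈𝒯 x u)) i
          (subst (λ t → BestMatch t σ x u) (sym child≡)
                 (bestMatch-cherry x u R (Unique-resp-↭ B↭ (block-unique B∈)) σx≢σu))

      cherryForest-¬bestMatch : ∀ {B x y y′} → B ∈ 𝒱 → x ∈ B → y ∈ B → y′ ∈ B → y′ ≢ y →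
                                σ y′ ≡ σ y → σ x ≢ σ y → ¬ BestMatch (cherryForest x y′) σ x y
      cherryForest-¬bestMatch {x = x} {y} {y′} B∈ x∈B y∈B y′∈B y′≢y σy′≡σy σx≢σy bm
        with cherryForest-child B∈ x∈B y′∈B (λ { refl → σx≢σy σy′≡σy })
      ... | i , R , child≡ , B↭ =
        ¬bestMatch-cherry x y′ R (Unique-resp-↭ B↭ (block-unique B∈)) y∈R σy′≡σy
          (subst (λ t → BestMatch t σ x y) child≡
                 (bestMatch-node⇒child _ i (∈-child (here refl)) (∈-child (there (there y∈R))) bm))
        where
        ∈-child : ∀ {z} → z ∈ x ∷ y′ ∷ R → z ∈ leaves (lookup (map (cherryOrStar x y′) 𝒱) i)
        ∈-child = subst (_ ∈_) (sym (trans (cong leaves child≡) (leaves-cherry x y′ R)))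
        y∈R : y ∈ R
        y∈R with ∈-resp-↭ B↭ y∈B
        ... | here refl         = contradiction refl σx≢σy
        ... | there (here refl) = contradiction refl y′≢y
        ... | there (there y∈)  = y∈

      Determined : V → V → Set → Set
      Determined x y Q = ∀ T → 𝒯 T → BestMatch T σ x y ⇔ Q

      determined-sameColour : ∀ {x y} → σ x ≡ σ y → Determined x y ⊥
      determined-sameColour σx≡σy _ _ = mk⇔ (λ bm → bestMatch⇒colours≢ bm σx≡σy) ⊥-elim

      determined-across : ∀ {B x y} → B ∈ 𝒱 → x ∈ B → y ∈ W → y ∉ B →
                          Determined x y (ColourAbsent (σ y) B)
      determined-across B∈ x∈B y∈W y∉B T T∈𝒯@((_ , T! , leaves≐W) , _)
        with child-of-block T∈𝒯 B∈
      ... | ts , i , refl , child≐B = mk⇔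
        (λ bm → All-resp-⊇ (λ {z} → from (child≐B z))
                  (bestMatch-across⁻ ts i (from (child≐B _) x∈B) (y∉B ∘ to (child≐B _)) bm))
        (λ absent → bestMatch-across ts T! i (from (child≐B _) x∈B) (from (leaves≐W _) y∈W)
                      (All-resp-⊇ (λ {z} → to (child≐B z)) absent))

      determined-uniqueColour : ∀ {B x y} → B ∈ 𝒱 → x ∈ B → y ∈ B → σ x ≢ σ y →
                                (∀ y′ → y′ ∈ B → σ y′ ≡ σ y → y′ ≡ y) → Determined x y ⊤
      determined-uniqueColour B∈ x∈B y∈B σx≢σy unique T T∈𝒯@((_ , T! , _) , _)
        with child-of-block T∈𝒯 B∈
      ... | ts , i , refl , child≐B = mk⇔ (λ _ → tt) λ _ →
        bestMatch-child⇒node ts T! i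
          (bestMatch-uniqueColour (lookup ts i) (Unique-child ts i T!)
                                  (from (child≐B _) x∈B) (from (child≐B _) y∈B) σx≢σy
                                  (λ y′ y′∈ → unique y′ (to (child≐B y′) y′∈)))

      module Step {E : Arcs V} (E? : Decidable E) where

        U : Arcs V
        U = U𝒲 (induced E W) σ W 𝒱

        U-outside : ∀ {x y} → ¬ (x ∈ W × y ∈ W) → ¬ U x y
        U-outside out u with u starForest starForest∈𝒯
        ... | inj₁ ((_ , x∈W , y∈W) , _) = out (x∈W , y∈W)
        ... | inj₂ (_ , x∈ , y∈ , _)     = out (to (leaves≐W _) x∈ , to (leaves≐W _) y∈)
          where leaves≐W = 𝒯⇒leaves≐ starForest∈𝒯

        U-determined : ∀ {x y Q} → x ∈ W → y ∈ W → Determined x y Q → U x y ⇔ (E x y ⊻ Q)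
        U-determined x∈ y∈ det =
          ⇔-trans (∀⊻-const (_ , starForest∈𝒯) det)
                  (⊻-cong (mk⇔ proj₁ (λ e → e , x∈ , y∈)) ⇔-refl)

        U-ambiguous : ∀ {B x y y′} → B ∈ 𝒱 → x ∈ B → y ∈ B → y′ ∈ B → y′ ≢ y → σ y′ ≡ σ y →
                      σ x ≢ σ y → ¬ U x y
        U-ambiguous {x = x} {y} {y′} B∈ x∈B y∈B y′∈B y′≢y σy′≡σy σx≢σy u
          with u (cherryForest x y) (cherryForest∈𝒯 x y) | u (cherryForest x y′) (cherryForest∈𝒯 x y′)
        ... | inj₁ (_ , ¬bm) | _              = ¬bm (cherryForest-bestMatch B∈ x∈B y∈B σx≢σy)
        ... | inj₂ (¬e , _)  | inj₁ (e , _)   = ¬e e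
        ... | inj₂ _         | inj₂ (_ , bm)  =
          cherryForest-¬bestMatch B∈ x∈B y∈B y′∈B y′≢y σy′≡σy σx≢σy bm

        U?-determined : ∀ {x y Q} → x ∈ W → y ∈ W → Determined x y Q → Dec Q → Dec (U x y)
        U?-determined x∈ y∈ det Q? = Dec-map (⇔-sym (U-determined x∈ y∈ det)) (⊻? (E? _ _) Q?)

        U? : Decidable U
        U? x y with x ∈? W | y ∈? W
        ... | no x∉ | _      = no (U-outside (x∉ ∘ proj₁))
        ... | yes _ | no y∉  = no (U-outside (y∉ ∘ proj₂))
        ... | yes x∈ | yes y∈ with block-of x∈
        ... | B , B∈ , x∈B with y ∈? B
        ... | no y∉B =
          U?-determined x∈ y∈ (determined-across B∈ x∈B y∈ y∉B) (colourAbsent? (σ y) B)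
        ... | yes y∈B with σ x ≟ℕ σ y
        ...   | yes σx≡σy = U?-determined x∈ y∈ (determined-sameColour σx≡σy) (no (λ ()))
        ...   | no σx≢σy with any? (λ y′ → (σ y′ ≟ℕ σ y) ×-dec ¬? (y′ ≟ y)) B
        ...     | yes ∃y′ = let y′ , y′∈B , σy′≡σy , y′≢y = find ∃y′ in
                            no (U-ambiguous B∈ x∈B y∈B y′∈B y′≢y σy′≡σy σx≢σy)
        ...     | no ∄y′  =
          U?-determined x∈ y∈ (determined-uniqueColour B∈ x∈B y∈B σx≢σy unique) (yes tt)
          where
          unique : ∀ y′ → y′ ∈ B → σ y′ ≡ σ y → y′ ≡ y
          unique y′ y′∈B σy′≡σy with y′ ≟ y
          ... | yes y′≡y = y′≡y
          ... | no y′≢y  = contradiction (lose y′∈B (σy′≡σy , y′≢y)) ∄y′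

        Edited : Arcs V
        Edited = E △ U

        edited-outside : ∀ {x y} → ¬ (x ∈ W × y ∈ W) → Edited x y ⇔ E x y
        edited-outside out = mk⇔ [ proj₁ , (λ (_ , u) → contradiction u (U-outside out)) ]
                                 (λ e → inj₁ (e , U-outside out))

        edited-determined : ∀ {x y Q} → x ∈ W → y ∈ W → Dec Q → Determined x y Q → Edited x y ⇔ Q
        edited-determined x∈ y∈ Q? det =
          ⇔-trans (⊻-cong ⇔-refl (U-determined x∈ y∈ det)) (⊻-cancelˡ (E? _ _) Q?)

        Edited? : Decidable Edited
        Edited? x y = ⊻? (E? x y) (U? x y)

        edited-loopless : ∀ {v} → v ∈ W → ¬ Edited v v
        edited-loopless v∈ = to (edited-determined v∈ v∈ (no (λ ())) (determined-sameColour refl))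

    Loopless : Arcs V → List V → Set
    Loopless E W = ∀ {v} → v ∈ W → ¬ E v v

    InOneChild : List (Tree V) → V → V → Set
    InOneChild ts x y = ∃ λ i → x ∈ leaves (lookup ts i) × y ∈ leaves (lookup ts i)

    record EditInvariant (E : Arcs V) (W : List V) (E* : Arcs V) (T : Tree V) : Set where
      field
        spans     : T spans W
        decidable : Decidable E*
        correct   : ∀ {x y} → x ∈ W → y ∈ W → E* x y ⇔ BestMatch T σ x y
        frame     : ∀ {x y} → ¬ (x ∈ W × y ∈ W) → E* x y ⇔ E x y

    record EditAllInvariant (E : Arcs V) (𝒱 : List (List V)) (E* : Arcs V) (ts : List (Tree V)) : Set where
      field
        spans     : Pointwise _spans_ ts 𝒱
        decidable : Decidable E*
        correct   : ∀ i {x y} → x ∈ leaves (lookup ts i) → y ∈ leaves (lookup ts i) →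
                    E* x y ⇔ BestMatch (lookup ts i) σ x y
        frame     : ∀ {x y} → ¬ InOneChild ts x y → E* x y ⇔ E x y

    open EditInvariant
    open EditAllInvariant

    edit-invariant : ∀ {E W E* T} → Edit σ E W E* T → Unique W → Decidable E → Loopless E W →
                     EditInvariant E W E* T
    editAll-invariant : ∀ {E 𝒱 E* ts} → EditAll σ E 𝒱 E* ts → Unique (concat 𝒱) → Decidable E →
                        Loopless E (concat 𝒱) → EditAllInvariant E 𝒱 E* ts

    edit-invariant {E} {v ∷ []} single _ E? loopless =
      record { spans = tt , ↭-refl ; decidable = E? ; correct = correct′ ; frame = λ _ → ⇔-refl }
      where
      correct′ : ∀ {x y} → x ∈ v ∷ [] → y ∈ v ∷ [] → E x y ⇔ BestMatch (leaf v) σ x y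
      correct′ (here refl) (here refl) =
        mk⇔ (⊥-elim ∘ loopless (here refl)) (λ bm → ⊥-elim (bestMatch⇒colours≢ bm refl))
    edit-invariant {E} {W} {E*} {node ts} (split {𝒱 = 𝒱} _ 𝒱-part 2≤|𝒱| run) W! E? loopless =
      record { spans = spans-resp-↭ (node-spans 2≤|𝒱| (spans r)) (proj₂ 𝒱-part)
             ; decidable = decidable r ; correct = correct′ ; frame = frame′ }
      where
      open Partition W! 𝒱-part 2≤|𝒱|
      open Step E?

      r : EditAllInvariant Edited 𝒱 E* ts
      r = editAll-invariant run (Unique-resp-↭ (↭-sym (proj₂ 𝒱-part)) W!) Edited?
                            (λ v∈ → edited-loopless (∈-resp-↭ (proj₂ 𝒱-part) v∈))

      T∈𝒯 : 𝒯 (node ts)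
      T∈𝒯 = node∈𝒯 (spans r)

      ∈-child⇒∈W : ∀ j {x} → x ∈ leaves (lookup ts j) → x ∈ W
      ∈-child⇒∈W j x∈ = to (𝒯⇒leaves≐ T∈𝒯 _) (∈-leaves-child ts j x∈)

      correct′ : ∀ {x y} → x ∈ W → y ∈ W → E* x y ⇔ BestMatch (node ts) σ x y
      correct′ {x} {y} x∈W y∈W with ∈-leavesL⁻ ts (from (𝒯⇒leaves≐ T∈𝒯 x) x∈W)
      ... | i , x∈i with y ∈? leaves (lookup ts i)
      ... | yes y∈i =
        ⇔-trans (correct r i x∈i y∈i) (bestMatch-child⇔node ts (𝒯⇒Unique T∈𝒯) i x∈i y∈i)
      ... | no y∉i with Pointwise-∈ˡ (spans r) (∈-lookup i)
      ... | B , B∈ , (_ , child↭B) =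
        ⇔-trans (frame r apart)
                (⇔-trans (edited-determined x∈W y∈W (colourAbsent? (σ y) B) across)
                         (⇔-sym (across (node ts) T∈𝒯)))
        where
        across = determined-across B∈ (∈-resp-↭ child↭B x∈i) y∈W (y∉i ∘ ∈-resp-↭ (↭-sym child↭B))
        apart : ¬ InOneChild ts x y
        apart (j , x∈j , y∈j) with child-unique ts (𝒯⇒Unique T∈𝒯) i j x∈i x∈j
        ... | refl = y∉i y∈j

      frame′ : ∀ {x y} → ¬ (x ∈ W × y ∈ W) → E* x y ⇔ E x y
      frame′ out =
        ⇔-trans (frame r (λ (j , x∈j , y∈j) → out (∈-child⇒∈W j x∈j , ∈-child⇒∈W j y∈j)))
                (edited-outside out)

    editAll-invariant [] _ E? _ =
      record { spans = [] ; decidable = E? ; correct = λ () ; frame = λ _ → ⇔-refl }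
    editAll-invariant {E} {B ∷ 𝒱} {E₂} {t ∷ ts} (run ∷ runs) B𝒱! E? loopless =
      record { spans = spans r₁ ∷ spans r₂ ; decidable = decidable r₂
             ; correct = correct′ ; frame = frame′ }
      where
      B∩𝒱=∅ : ∀ {v} → v ∈ B → v ∉ concat 𝒱
      B∩𝒱=∅ v∈B v∈𝒱 = Unique-++⇒Disjoint B B𝒱! (v∈B , v∈𝒱)

      r₁ = edit-invariant run (Unique-++⁻ˡ B B𝒱!) E? (λ v∈ → loopless (∈-++⁺ˡ v∈))
      r₂ = editAll-invariant runs (Unique-++⁻ʳ B B𝒱!) (decidable r₁)
             (λ v∈ → loopless (∈-++⁺ʳ B v∈) ∘ to (frame r₁ (λ (v∈B , _) → B∩𝒱=∅ v∈B v∈)))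

      ∈t⇒∈B : ∀ {v} → v ∈ leaves t → v ∈ B
      ∈t⇒∈B = ∈-resp-↭ (proj₂ (spans r₁))

      ∈B⇒∈t : ∀ {v} → v ∈ B → v ∈ leaves t
      ∈B⇒∈t = ∈-resp-↭ (↭-sym (proj₂ (spans r₁)))

      correct′ : ∀ i {x y} → x ∈ leaves (lookup (t ∷ ts) i) → y ∈ leaves (lookup (t ∷ ts) i) →
                 E₂ x y ⇔ BestMatch (lookup (t ∷ ts) i) σ x y
      correct′ zero    x∈t y∈t = ⇔-trans (frame r₂ x∉ts) (correct r₁ (∈t⇒∈B x∈t) (∈t⇒∈B y∈t))
        where
        x∉ts : ¬ InOneChild ts _ _
        x∉ts (j , x∈j , _) =
          B∩𝒱=∅ (∈t⇒∈B x∈t) (∈-resp-↭ (leavesL-spans (spans r₂)) (∈-leaves-child ts j x∈j))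
      correct′ (suc i) = correct r₂ i

      frame′ : ∀ {x y} → ¬ InOneChild (t ∷ ts) x y → E₂ x y ⇔ E x y
      frame′ apart = ⇔-trans (frame r₂ (λ (j , in-j) → apart (suc j , in-j)))
                             (frame r₁ (λ (x∈B , y∈B) → apart (zero , ∈B⇒∈t x∈B , ∈B⇒∈t y∈B)))

theorem1 : (n : ℕ) → 1 ≤ n → (E : Arcs (Fin n)) → (σ : Fin n → ℕ) →
           (∀ x y → Dec (E x y)) → NoLoops E → Proper E σ →
           ∀ (E* : Arcs (Fin n)) (T : Tree (Fin n)) →
           Edit σ E (allFin n) E* T →
           (E* ≐ᴬ BMG T σ) × IsBMG E* σ (allFin n)
theorem1 n _ E σ E? noLoops _ E* T run =
  E*≐G , T , spans⇒TreeOn (allFin⁺ n) (EditInvariant.spans inv) , E*≐G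
  where
  inv = edit-invariant σ _≟F_ run (allFin⁺ n) E? (λ {v} _ → noLoops v)
  E*≐G : E* ≐ᴬ BMG T σ
  E*≐G x y = EditInvariant.correct inv (∈-allFin x) (∈-allFin y)
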